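{- Let $\mathbb F$ be a finite field with $q^r$ elements ($q$ a prime power, $r>1$), $\tau$ a primitive element of $\mathbb F$, $\theta=\tau^{q-1}$, and $t=(q^r-1)/(q-1)$. Let $N=\{\begin{pmatrix}1&0\\ \alpha&1\end{pmatrix}:\alpha\in\mathbb F\}$, $\psi^{+}:N\to\mathbb F$ the isomorphism onto $(\mathbb F,+)$ sending $\begin{pmatrix}1&0\\ \alpha&1\end{pmatrix}$ to $\alpha$, $f=\begin{pmatrix}1&0\\ 0&\theta\end{pmatrix}$, and $G=N\langle f\rangle$. Let $M\le N$ be such that $\psi^+(M)$ is an $(r-1)$-dimensional $\mathbb F_q$-subspace of $\mathbb F$, and for each integer $i$ let $M_i\le N$ be defined by $\psi^+(M_i)=\psi^+(M)\tau^i$ (so $M_1,\dots,M_t$ are all such subgroups, and indices are read modulo $t$). Let $\varphi$ be a permutation of $\{1,\dots,t\}$ (extended to all integers by reading arguments modulo $t$), and put $$S=\bigcup_{i=1}^{t} f^i\,(N\setminus M_{\varphi(i)}),\qquad f^i(N\setminus M_{\varphi(i)})=\{f^ia: a\in N\setminus M_{\varphi(i)}\}.$$ Then $S$ is closed under inversion in $G$ if and only if for every integer $i$, $$\psi^{+}(M_{\varphi(i)})\,\theta^{i}=\psi^{+}(M_{\varphi(t-i)}).$$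
   Context: All matrices are $2\times 2$ matrices over $\mathbb F$ under matrix multiplication; $\mathbb F$ is regarded as an $r$-dimensional vector space over its subfield $\mathbb F_q$. The element $f$ has order $t$, so exponents of $f$ and indices $i$ are understood modulo $t$ (with index $0$ identified with $t$). -}

module Defs where

open import Level using (Level; _⊔_)
open import Algebra.Bundles using (CommutativeRing)
open import Data.Nat as ℕ using (ℕ; zero; suc; _∸_; _%_; _≤_)
open import Data.Nat.Primality using (Prime)
open import Data.Fin using (Fin; toℕ; fromℕ<)
open import Data.Fin.Permutation using (Permutation′; _⟨$⟩ʳ_)
open import Data.Product using (Σ; ∃; _×_)
open import Function.Bundles using (_⇔_)
open import Relation.Nullary using (¬_)
open import Data.Nat.DivMod using (m%n<n)
import Data.Fin as Fin
open import Relation.Binary.PropositionalEquality using (_≡_)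

IsPrimePower : ℕ → Set
IsPrimePower q = Σ ℕ λ p → Σ ℕ λ k → Prime p × 1 ≤ k × q ≡ p ℕ.^ k

module FieldNotions {c ℓ : Level} (F : CommutativeRing c ℓ) where
  open CommutativeRing F

  _^_ : Carrier → ℕ → Carrier
  x ^ zero = 1#
  x ^ suc n = x * (x ^ n)

  IsField : Set (c ⊔ ℓ)
  IsField = (¬ (1# ≈ 0#)) × (∀ x → ¬ (x ≈ 0#) → ∃ λ y → x * y ≈ 1#)

  HasCard : ℕ → Set (c ⊔ ℓ)
  HasCard n = Σ (Fin n → Carrier) λ e →
    (∀ i j → e i ≈ e j → i ≡ j) × (∀ x → ∃ λ i → e i ≈ x)

  Primitive : Carrier → Set (c ⊔ ℓ)
  Primitive τ = ∀ x → ¬ (x ≈ 0#) → ∃ λ k → x ≈ τ ^ k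

  -- the subfield F_q = { x | x^q = x }  (F has q^r elements, q a prime power)
  InFq : ℕ → Carrier → Set ℓ
  InFq q x = x ^ q ≈ x

  Σᶠ : (n : ℕ) → (Fin n → Carrier) → Carrier
  Σᶠ zero v = 0#
  Σᶠ (suc n) v = v Fin.zero + Σᶠ n (λ j → v (Fin.suc j))

  InSpan : (q : ℕ) {m : ℕ} → (Fin m → Carrier) → Carrier → Set (c ⊔ ℓ)
  InSpan q {m} b x = Σ (Fin m → Carrier) λ cf →
    (∀ j → InFq q (cf j)) × (x ≈ Σᶠ m (λ j → cf j * b j))

  LinIndep : (q : ℕ) {m : ℕ} → (Fin m → Carrier) → Set (c ⊔ ℓ)
  LinIndep q {m} b = ∀ (cf : Fin m → Carrier) → (∀ j → InFq q (cf j)) →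
    Σᶠ m (λ j → cf j * b j) ≈ 0# → ∀ j → cf j ≈ 0#

  record Mat : Set c where
    constructor mat
    field a₁₁ a₁₂ a₂₁ a₂₂ : Carrier
  open Mat public

  infixl 7 _·_
  infix 4 _≈ₘ_
  infixr 8 _^ₘ_ _^_
  _·_ : Mat → Mat → Mat
  A · B = mat (a₁₁ A * a₁₁ B + a₁₂ A * a₂₁ B) (a₁₁ A * a₁₂ B + a₁₂ A * a₂₂ B)
              (a₂₁ A * a₁₁ B + a₂₂ A * a₂₁ B) (a₂₁ A * a₁₂ B + a₂₂ A * a₂₂ B)

  _≈ₘ_ : Mat → Mat → Set ℓ
  A ≈ₘ B = (a₁₁ A ≈ a₁₁ B) × (a₁₂ A ≈ a₁₂ B) × (a₂₁ A ≈ a₂₁ B) × (a₂₂ A ≈ a₂₂ B)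

  Iₘ : Mat
  Iₘ = mat 1# 0# 0# 1#

  _^ₘ_ : Mat → ℕ → Mat
  A ^ₘ zero = Iₘ
  A ^ₘ suc n = A · (A ^ₘ n)

  nElt : Carrier → Mat
  nElt α = mat 1# 0# α 1#

  -- membership of α in ψ⁺(M_j) = ψ⁺(M) τ^j, where ψ⁺(M) = F_q-span of b
  InMj : (q : ℕ) {m : ℕ} (b : Fin m → Carrier) (τ : Carrier) → ℕ → Carrier → Set (c ⊔ ℓ)
  InMj q b τ j α = ∃ λ w → InSpan q b w × (α ≈ w * (τ ^ j))

  -- index i (an integer read mod t) as an element of Fin t (residue 0 stands for t)
  idx : (t : ℕ) .{{_ : ℕ.NonZero t}} → ℕ → Fin t
  idx t i = fromℕ< (m%n<n i t)

  -- φ extended to all indices (mod t); result read as index in ℕ (0 ≡ t mod t)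
  φ̂ : (t : ℕ) .{{_ : ℕ.NonZero t}} → Permutation′ t → ℕ → ℕ
  φ̂ t φ i = toℕ (φ ⟨$⟩ʳ idx t i)

  negMod : (t : ℕ) .{{_ : ℕ.NonZero t}} → ℕ → ℕ
  negMod t i = t ∸ (i % t)

  InS : (q : ℕ) {m : ℕ} (b : Fin m → Carrier) (τ θ : Carrier)
        (t : ℕ) .{{_ : ℕ.NonZero t}} (φ : Permutation′ t) → Mat → Set (c ⊔ ℓ)
  InS q b τ θ t φ X = ∃ λ i → (1 ≤ i) × (i ≤ t) × ∃ λ α →
    (¬ InMj q b τ (φ̂ t φ i) α) × (X ≈ₘ ((mat 1# 0# 0# θ ^ₘ i) · nElt α))

  InverseClosed : (Mat → Set (c ⊔ ℓ)) → Set (c ⊔ ℓ)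
  InverseClosed P = ∀ X → P X → ∃ λ Y → P Y × (X · Y ≈ₘ Iₘ)

-- Every element of S is fⁱ n(α) = [[1, 0], [θⁱα, θⁱ]] with 1 ≤ i ≤ t and α ∉ M_φ(i), and its inverse is
-- f⁻ⁱ n(-θⁱα). Because θ has order exactly t (τ is primitive), that inverse can only lie in S as an element
-- of f^(t-i) N, so S is inverse-closed iff θⁱα ∉ M_φ(t-i) whenever α ∉ M_φ(i) (the M_j are F_q-subspaces
-- and -1 ∈ F_q). Membership being decidable (F is finite), this says M_φ(t-i) ⊆ θⁱ M_φ(i) for all i;
-- the same inclusion for t - i, multiplied by θⁱ, gives the reverse one.
module Submission where

open import Defs
open import Level using (Level; _⊔_)
open import Algebra.Bundles using (CommutativeRing)
import Algebra.Properties.CommutativeSemiring.Exp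
open import Data.Nat as ℕ using (ℕ; zero; suc; _∸_; _%_; _/_; _≤_; _<_; z≤n; s≤s)
import Data.Nat.Properties as ℕ
open import Data.Nat.DivMod
open import Data.Nat.Divisibility
open import Data.Nat.Primality using (prime⇒nonTrivial; prime⇒nonZero)
open import Data.Fin as Fin using (Fin; toℕ; fromℕ<; punchIn; punchOut)
import Data.Fin.Properties as Fin
open import Data.Fin.Permutation using (Permutation′; _⟨$⟩ʳ_)
open import Data.Vec.Functional using (Vector; head; tail; _∷_; [])
open import Data.Product using (∃; _×_; _,_; proj₁; proj₂)
open import Function.Base using (_∘_)
open import Function.Bundles using (_⇔_; mk⇔; Equivalence)
open import Function.Definitions using (Injective)
open import Relation.Binary.Definitions using (Decidable; _Respects_)
open import Relation.Binary.PropositionalEquality as ≡ using (_≡_; _≢_)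
open import Relation.Nullary using (¬_; Dec; contradiction)
open import Relation.Nullary.Decidable using (map′; _×-dec_; decidable-stable)

module Powers {c ℓ : Level} (F : CommutativeRing c ℓ) where
  open CommutativeRing F
  open FieldNotions F
  open import Relation.Binary.Reasoning.Setoid setoid
  private module Exp = Algebra.Properties.CommutativeSemiring.Exp commutativeSemiring

  ^≡Exp^ : ∀ x n → x ^ n ≡ x Exp.^ n
  ^≡Exp^ x zero = ≡.refl
  ^≡Exp^ x (suc n) = ≡.cong (x *_) (^≡Exp^ x n)

  ^-congˡ : ∀ n {x y} → x ≈ y → x ^ n ≈ y ^ n
  ^-congˡ n {x} {y} rewrite ^≡Exp^ x n | ^≡Exp^ y n = Exp.^-congˡ n

  ^-homo-* : ∀ x m n → x ^ (m ℕ.+ n) ≈ x ^ m * x ^ n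
  ^-homo-* x m n rewrite ^≡Exp^ x (m ℕ.+ n) | ^≡Exp^ x m | ^≡Exp^ x n = Exp.^-homo-* x m n

  ^-assocʳ : ∀ x m n → (x ^ m) ^ n ≈ x ^ (m ℕ.* n)
  ^-assocʳ x m n rewrite ^≡Exp^ (x ^ m) n | ^≡Exp^ x m | ^≡Exp^ x (m ℕ.* n) = Exp.^-assocʳ x m n

  ^-distrib-* : ∀ x y n → (x * y) ^ n ≈ x ^ n * y ^ n
  ^-distrib-* x y n rewrite ^≡Exp^ (x * y) n | ^≡Exp^ x n | ^≡Exp^ y n = Exp.^-distrib-* x y n

  1^n≈1 : ∀ n → 1# ^ n ≈ 1#
  1^n≈1 zero = refl
  1^n≈1 (suc n) = trans (*-identityˡ _) (1^n≈1 n)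

  HasOrder : Carrier → ℕ → Set ℓ
  HasOrder x n = ∀ k → x ^ k ≈ 1# ⇔ n ∣ k

  ^-∣ : ∀ {x d k} → x ^ d ≈ 1# → d ∣ k → x ^ k ≈ 1#
  ^-∣ {x} {d} x^d≈1 (divides j ≡.refl) = begin
    x ^ (j ℕ.* d) ≡⟨ ≡.cong (x ^_) (ℕ.*-comm j d) ⟩
    x ^ (d ℕ.* j) ≈⟨ sym (^-assocʳ x d j) ⟩
    (x ^ d) ^ j   ≈⟨ ^-congˡ j x^d≈1 ⟩
    1# ^ j        ≈⟨ 1^n≈1 j ⟩
    1#            ∎

  ^-% : ∀ {x d} .{{_ : ℕ.NonZero d}} → x ^ d ≈ 1# → ∀ m → x ^ m ≈ x ^ (m % d)
  ^-% {x} {d} x^d≈1 m = begin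
    x ^ m                             ≡⟨ ≡.cong (x ^_) (m≡m%n+[m/n]*n m d) ⟩
    x ^ (m % d ℕ.+ m / d ℕ.* d)       ≈⟨ ^-homo-* x (m % d) _ ⟩
    x ^ (m % d) * x ^ (m / d ℕ.* d)   ≈⟨ *-congˡ (^-∣ x^d≈1 (n∣m*n (m / d))) ⟩
    x ^ (m % d) * 1#                  ≈⟨ *-identityʳ _ ⟩
    x ^ (m % d)                       ∎

  ^-cong-% : ∀ {x d} .{{_ : ℕ.NonZero d}} → x ^ d ≈ 1# →
             ∀ {m n} → m % d ≡ n % d → x ^ m ≈ x ^ n
  ^-cong-% {x} x^d≈1 {m} {n} m≡n = begin
    x ^ m       ≈⟨ ^-% x^d≈1 m ⟩
    x ^ (m % _) ≡⟨ ≡.cong (x ^_) m≡n ⟩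
    x ^ (n % _) ≈⟨ ^-% x^d≈1 n ⟨
    x ^ n       ∎

  minimal⇒HasOrder : ∀ {x n} .{{_ : ℕ.NonZero n}} → x ^ n ≈ 1# →
                     (∀ k → 0 < k → x ^ k ≈ 1# → n ≤ k) → HasOrder x n
  minimal⇒HasOrder {x} {n} x^n≈1 minimal k = mk⇔ to (^-∣ x^n≈1)
    where
    to : x ^ k ≈ 1# → n ∣ k
    to x^k≈1 with k % n in k%n≡r
    ... | zero  = m%n≡0⇒n∣m k n k%n≡r
    ... | suc r = contradiction (minimal (suc r) (s≤s z≤n) x^r≈1)
                    (ℕ.<⇒≱ (≡.subst (_< n) k%n≡r (m%n<n k n)))
      where
      x^r≈1 : x ^ suc r ≈ 1#
      x^r≈1 = trans (sym (≡.subst (λ u → x ^ k ≈ x ^ u) k%n≡r (^-% x^n≈1 k))) x^k≈1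

  HasOrder-^ : ∀ {x y t e} .{{_ : ℕ.NonZero e}} →
               HasOrder x (t ℕ.* e) → y ≈ x ^ e → HasOrder y t
  HasOrder-^ {x} {y} {t} {e} x-order y≈x^e k = mk⇔
    (λ y^k≈1 → *-cancelʳ-∣ e (≡.subst (t ℕ.* e ∣_) (ℕ.*-comm e k)
                 (Equivalence.to (x-order (e ℕ.* k)) (trans (sym y^k≈x^ek) y^k≈1))))
    (λ t∣k → trans y^k≈x^ek (Equivalence.from (x-order (e ℕ.* k))
                 (≡.subst (t ℕ.* e ∣_) (ℕ.*-comm k e) (*-monoˡ-∣ e t∣k))))
    where
    y^k≈x^ek : y ^ k ≈ x ^ (e ℕ.* k)
    y^k≈x^ek = trans (^-congˡ k y≈x^e) (^-assocʳ x e k)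

module LowerTriangular {c ℓ : Level} (F : CommutativeRing c ℓ) where
  open CommutativeRing F
  open FieldNotions F

  ≈ₘ-refl : ∀ {A} → A ≈ₘ A
  ≈ₘ-refl = refl , refl , refl , refl

  ≈ₘ-sym : ∀ {A B} → A ≈ₘ B → B ≈ₘ A
  ≈ₘ-sym (a , b , c , d) = sym a , sym b , sym c , sym d

  ≈ₘ-trans : ∀ {A B C} → A ≈ₘ B → B ≈ₘ C → A ≈ₘ C
  ≈ₘ-trans (a , b , c , d) (a′ , b′ , c′ , d′) = trans a a′ , trans b b′ , trans c c′ , trans d d′

  ·-cong : ∀ {A A′ B B′} → A ≈ₘ A′ → B ≈ₘ B′ → A · B ≈ₘ A′ · B′
  ·-cong (a₁ , a₂ , a₃ , a₄) (b₁ , b₂ , b₃ , b₄) =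
    +-cong (*-cong a₁ b₁) (*-cong a₂ b₃) , +-cong (*-cong a₁ b₂) (*-cong a₂ b₄) ,
    +-cong (*-cong a₃ b₁) (*-cong a₄ b₃) , +-cong (*-cong a₃ b₂) (*-cong a₄ b₄)

  lower : Carrier → Carrier → Mat
  lower a d = mat 1# 0# a d

  lower-· : ∀ a d a′ d′ → lower a d · lower a′ d′ ≈ₘ lower (a + d * a′) (d * d′)
  lower-· a d a′ d′ =
    trans (+-cong (*-identityˡ 1#) (zeroˡ a′)) (+-identityʳ 1#) ,
    trans (+-cong (zeroʳ 1#) (zeroˡ d′)) (+-identityʳ 0#) ,
    +-congʳ (*-identityʳ a) ,
    trans (+-congʳ (zeroʳ a)) (+-identityˡ _)

  diag^ : ∀ θ i → mat 1# 0# 0# θ ^ₘ i ≈ₘ lower 0# (θ ^ i)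
  diag^ θ zero = ≈ₘ-refl
  diag^ θ (suc i) = ≈ₘ-trans (·-cong ≈ₘ-refl (diag^ θ i))
    (≈ₘ-trans (lower-· 0# θ 0# (θ ^ i)) (refl , refl , trans (+-identityˡ _) (zeroʳ θ) , refl))

  diag^·nElt : ∀ θ i α → mat 1# 0# 0# θ ^ₘ i · nElt α ≈ₘ lower (θ ^ i * α) (θ ^ i)
  diag^·nElt θ i α = ≈ₘ-trans (·-cong (diag^ θ i) ≈ₘ-refl)
    (≈ₘ-trans (lower-· 0# (θ ^ i) α 1#) (refl , refl , +-identityˡ _ , *-identityʳ _))

module Spans {c ℓ : Level} (F : CommutativeRing c ℓ) where
  open CommutativeRing F
  open FieldNotions F
  open Powers F
  open import Algebra.Properties.Monoid.Sum +-monoid using (sum; sum-cong-≋)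
  open import Algebra.Properties.Semiring.Sum semiring using (*-distribˡ-sum)
  open import Algebra.Properties.Ring ring using (-1*x≈-x)

  Σᶠ≡sum : ∀ n (v : Vector Carrier n) → Σᶠ n v ≡ sum v
  Σᶠ≡sum zero v = ≡.refl
  Σᶠ≡sum (suc n) v = ≡.cong (v Fin.zero +_) (Σᶠ≡sum n (tail v))

  Σᶠ-cong : ∀ n {v w : Vector Carrier n} → (∀ j → v j ≈ w j) → Σᶠ n v ≈ Σᶠ n w
  Σᶠ-cong n {v} {w} rewrite Σᶠ≡sum n v | Σᶠ≡sum n w = sum-cong-≋

  *-distribˡ-Σᶠ : ∀ n x (v : Vector Carrier n) → x * Σᶠ n v ≈ Σᶠ n (λ j → x * v j)
  *-distribˡ-Σᶠ n x v rewrite Σᶠ≡sum n v | Σᶠ≡sum n (λ j → x * v j) = *-distribˡ-sum x v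

  module _ (q : ℕ) where

    InFq-resp : InFq q Respects _≈_
    InFq-resp x≈y x^q≈x = trans (^-congˡ q (sym x≈y)) (trans x^q≈x x≈y)

    InFq-* : ∀ {x y} → InFq q x → InFq q y → InFq q (x * y)
    InFq-* {x} {y} x^q≈x y^q≈y = trans (^-distrib-* x y q) (*-cong x^q≈x y^q≈y)

    module _ {m : ℕ} (b : Vector Carrier m) where

      InSpan-resp : InSpan q b Respects _≈_
      InSpan-resp x≈y (cf , cf∈Fq , x≈Σ) = cf , cf∈Fq , trans (sym x≈y) x≈Σ

      InSpan-* : ∀ {x w} → InFq q x → InSpan q b w → InSpan q b (x * w)
      InSpan-* {x} x∈Fq (cf , cf∈Fq , w≈Σ) =
        (λ j → x * cf j) , (λ j → InFq-* x∈Fq (cf∈Fq j)) ,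
        trans (*-congˡ w≈Σ) (trans (*-distribˡ-Σᶠ m x _) (Σᶠ-cong m (λ j → sym (*-assoc x (cf j) (b j)))))

      module _ (τ : Carrier) (j : ℕ) where

        InMj-resp : InMj q b τ j Respects _≈_
        InMj-resp x≈y (w , w∈span , x≈wτʲ) = w , w∈span , trans (sym x≈y) x≈wτʲ

        InMj-* : ∀ {x α} → InFq q x → InMj q b τ j α → InMj q b τ j (x * α)
        InMj-* x∈Fq (w , w∈span , α≈wτʲ) =
          _ , InSpan-* x∈Fq w∈span , trans (*-congˡ α≈wτʲ) (sym (*-assoc _ w _))

        InMj-neg : InFq q (- 1#) → ∀ {α} → InMj q b τ j α → InMj q b τ j (- α)
        InMj-neg -1∈Fq {α} α∈Mj = InMj-resp (-1*x≈-x α) (InMj-* -1∈Fq α∈Mj)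

module FiniteSearch {c ℓ : Level} (F : CommutativeRing c ℓ) {n : ℕ}
                    (card : FieldNotions.HasCard F n) where
  open CommutativeRing F
  open FieldNotions F
  open Spans F

  enum : Fin n → Carrier
  enum = proj₁ card

  enum-injective : ∀ i j → enum i ≈ enum j → i ≡ j
  enum-injective = proj₁ (proj₂ card)

  enum-surjective : ∀ x → ∃ λ i → enum i ≈ x
  enum-surjective = proj₂ (proj₂ card)

  infix 4 _≈?_
  _≈?_ : Decidable _≈_
  x ≈? y with enum-surjective x | enum-surjective y
  ... | i , i↦x | j , j↦y =
    map′ (λ { ≡.refl → trans (sym i↦x) j↦y })
         (λ x≈y → enum-injective i j (trans i↦x (trans x≈y (sym j↦y))))
         (i Fin.≟ j)

  ∃? : ∀ {p} (P : Carrier → Set p) → P Respects _≈_ → (∀ x → Dec (P x)) → Dec (∃ P)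
  ∃? P resp P? = map′ (λ (i , Pi) → enum i , Pi)
                      (λ (x , Px) → let (i , i↦x) = enum-surjective x in i , resp (sym i↦x) Px)
                      (Fin.any? (P? ∘ enum))

  ∃?-Vector : ∀ {p} m (P : Vector Carrier m → Set p) →
              (∀ {u v} → (∀ j → u j ≈ v j) → P u → P v) →
              (∀ v → Dec (P v)) → Dec (∃ P)
  ∃?-Vector zero P resp P? = map′ (_ ,_) (λ (v , Pv) → resp (λ ()) Pv) (P? [])
  ∃?-Vector (suc m) P resp P? =
    map′ (λ (x , v , Px∷v) → x ∷ v , Px∷v)
         (λ (u , Pu) → head u , tail u , resp (λ { Fin.zero → refl ; (Fin.suc j) → refl }) Pu)
         (∃? (λ x → ∃ λ v → P (x ∷ v))
             (λ x≈y (v , Px∷v) → v , resp (λ { Fin.zero → x≈y ; (Fin.suc j) → refl }) Px∷v)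
             (λ x → ∃?-Vector m (λ v → P (x ∷ v))
                      (λ u≈v → resp (λ { Fin.zero → refl ; (Fin.suc j) → u≈v j }))
                      (λ v → P? (x ∷ v))))

  InSpan? : ∀ q {m} (b : Vector Carrier m) x → Dec (InSpan q b x)
  InSpan? q {m} b x = ∃?-Vector m _
    (λ cf≈cf′ (cf∈Fq , x≈Σ) → (λ j → InFq-resp q (cf≈cf′ j) (cf∈Fq j)) ,
                                trans x≈Σ (Σᶠ-cong m (λ j → *-congʳ (cf≈cf′ j))))
    (λ cf → Fin.all? (λ j → cf j ^ q ≈? cf j) ×-dec (x ≈? Σᶠ m (λ j → cf j * b j)))

  InMj? : ∀ q {m} (b : Vector Carrier m) τ j α → Dec (InMj q b τ j α)
  InMj? q b τ j α = ∃? _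
    (λ w≈w′ (w∈span , α≈wτʲ) → InSpan-resp q b w≈w′ w∈span , trans α≈wτʲ (*-congʳ w≈w′))
    (λ w → InSpan? q b w ×-dec (α ≈? w * τ ^ j))

module PrimitiveElement {c ℓ : Level} (F : CommutativeRing c ℓ)
  (isField : FieldNotions.IsField F)
  {N : ℕ} (card : FieldNotions.HasCard F (suc N)) (2≤N : 2 ≤ N)
  (τ : CommutativeRing.Carrier F) (τ-primitive : FieldNotions.Primitive F τ) where
  open CommutativeRing F
  open FieldNotions F
  open Powers F
  open import Relation.Binary.Reasoning.Setoid setoid
  open import Algebra.Properties.Ring ring using (-1*x≈-x; -‿involutive; -0#≈0#)

  1≉0 : ¬ 1# ≈ 0#
  1≉0 = proj₁ isField

  *-cancelˡ : ∀ {x a b} → ¬ x ≈ 0# → x * a ≈ x * b → a ≈ b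
  *-cancelˡ {x} {a} {b} x≉0 xa≈xb = begin
    a             ≈⟨ *-identityˡ a ⟨
    1# * a        ≈⟨ *-congʳ (trans (*-comm y x) xy≈1) ⟨
    (y * x) * a   ≈⟨ *-assoc y x a ⟩
    y * (x * a)   ≈⟨ *-congˡ xa≈xb ⟩
    y * (x * b)   ≈⟨ *-assoc y x b ⟨
    (y * x) * b   ≈⟨ *-congʳ (trans (*-comm y x) xy≈1) ⟩
    1# * b        ≈⟨ *-identityˡ b ⟩
    b             ∎
    where
    y = proj₁ (proj₂ isField x x≉0)
    xy≈1 = proj₂ (proj₂ isField x x≉0)

  *-≉0 : ∀ {x y} → ¬ x ≈ 0# → ¬ y ≈ 0# → ¬ x * y ≈ 0#
  *-≉0 {x} x≉0 y≉0 xy≈0 = y≉0 (*-cancelˡ x≉0 (trans xy≈0 (sym (zeroʳ x))))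

  open FiniteSearch F card using (enum; enum-injective; enum-surjective)

  private
    zeroIndex : Fin (suc N)
    zeroIndex = proj₁ (enum-surjective 0#)

  nonzero : Fin N → Carrier
  nonzero = enum ∘ punchIn zeroIndex

  nonzero-injective : ∀ k l → nonzero k ≈ nonzero l → k ≡ l
  nonzero-injective k l eq = Fin.punchIn-injective zeroIndex k l (enum-injective _ _ eq)

  nonzero-≉0 : ∀ k → ¬ nonzero k ≈ 0#
  nonzero-≉0 k k↦0 = Fin.punchInᵢ≢i zeroIndex k
    (enum-injective _ _ (trans k↦0 (sym (proj₂ (enum-surjective 0#)))))

  nonzero-surjective : ∀ x → ¬ x ≈ 0# → ∃ λ k → nonzero k ≈ x
  nonzero-surjective x x≉0 with enum-surjective x
  ... | i , i↦x = punchOut zeroIndex≢i , trans (reflexive (≡.cong enum (Fin.punchIn-punchOut zeroIndex≢i))) i↦x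
    where
    zeroIndex≢i : zeroIndex ≢ i
    zeroIndex≢i ≡.refl = x≉0 (trans (sym i↦x) (proj₂ (enum-surjective 0#)))

  log : ∀ x → ¬ x ≈ 0# → ℕ
  log x x≉0 = proj₁ (τ-primitive x x≉0)

  τ^log : ∀ x x≉0 → τ ^ log x x≉0 ≈ x
  τ^log x x≉0 = sym (proj₂ (τ-primitive x x≉0))

  -- If τ were 0, its powers would only reach 0 and 1, but there are two distinct nonzero elements.
  τ≉0 : ¬ τ ≈ 0#
  τ≉0 τ≈0 = 0≢1 (≡.trans (≡.sym (Fin.toℕ-fromℕ< 0<N))
                 (≡.trans (≡.cong toℕ (nonzero-injective _ _ (trans (≈1 _) (sym (≈1 _)))))
                          (Fin.toℕ-fromℕ< 2≤N)))
    where
    0<N : 0 < N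
    0<N = ℕ.≤-trans (s≤s z≤n) 2≤N

    0≢1 : 0 ≢ 1
    0≢1 ()

    ≈1 : ∀ k → nonzero k ≈ 1#
    ≈1 k with log (nonzero k) (nonzero-≉0 k) | τ^log (nonzero k) (nonzero-≉0 k)
    ... | zero  | 1≈k   = sym 1≈k
    ... | suc e | τ^e≈k = contradiction (trans (sym τ^e≈k) (trans (*-congʳ τ≈0) (zeroˡ _))) (nonzero-≉0 k)

  τ^≉0 : ∀ k → ¬ τ ^ k ≈ 0#
  τ^≉0 zero = 1≉0
  τ^≉0 (suc k) = *-≉0 τ≉0 (τ^≉0 k)

  -- Reducing logarithms mod d injects the N nonzero elements into Fin d.
  N≤order : ∀ d → 0 < d → τ ^ d ≈ 1# → N ≤ d
  N≤order d@(suc _) _ τ^d≈1 = Fin.injective⇒≤ {f = logMod} logMod-injective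
    where
    logNonzero : Fin N → ℕ
    logNonzero k = log (nonzero k) (nonzero-≉0 k)

    logMod : Fin N → Fin d
    logMod k = fromℕ< (m%n<n (logNonzero k) d)

    logMod-injective : Injective _≡_ _≡_ logMod
    logMod-injective {k} {l} same = nonzero-injective k l (begin
      nonzero k            ≈⟨ τ^log _ (nonzero-≉0 k) ⟨
      τ ^ logNonzero k     ≈⟨ ^-cong-% τ^d≈1 {logNonzero k} {logNonzero l}
                              (Fin.fromℕ<-injective _ _ (m%n<n (logNonzero k) d) (m%n<n (logNonzero l) d) same) ⟩
      τ ^ logNonzero l     ≈⟨ τ^log _ (nonzero-≉0 l) ⟩
      nonzero l            ∎)

  private
    powerIndex : Fin (suc N) → Fin N
    powerIndex k = proj₁ (nonzero-surjective (τ ^ toℕ k) (τ^≉0 (toℕ k)))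

    powerIndex-correct : ∀ k → nonzero (powerIndex k) ≈ τ ^ toℕ k
    powerIndex-correct k = proj₂ (nonzero-surjective (τ ^ toℕ k) (τ^≉0 (toℕ k)))

  -- Two of the N + 1 nonzero powers τ⁰, …, τᴺ coincide.
  τ^N≈1 : τ ^ N ≈ 1#
  τ^N≈1 with Fin.pigeonhole (ℕ.n<1+n N) powerIndex
  ... | i , j , i<j , same =
    ≡.subst (λ d → τ ^ d ≈ 1#) (ℕ.≤-antisym d≤N (N≤order d (ℕ.m<n⇒0<n∸m i<j) τ^d≈1)) τ^d≈1
    where
    a = toℕ i
    b = toℕ j
    d = b ∸ a

    d≤N : d ≤ N
    d≤N = ℕ.≤-trans (ℕ.m∸n≤m b a) (ℕ.≤-pred (Fin.toℕ<n j))

    τ^d≈1 : τ ^ d ≈ 1#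
    τ^d≈1 = *-cancelˡ (τ^≉0 a) (begin
      τ ^ a * τ ^ d                ≈⟨ ^-homo-* τ a d ⟨
      τ ^ (a ℕ.+ d)                ≡⟨ ≡.cong (τ ^_) (ℕ.m+[n∸m]≡n (ℕ.<⇒≤ i<j)) ⟩
      τ ^ b                        ≈⟨ powerIndex-correct j ⟨
      nonzero (powerIndex j)       ≡⟨ ≡.cong nonzero same ⟨
      nonzero (powerIndex i)       ≈⟨ powerIndex-correct i ⟩
      τ ^ a                        ≈⟨ *-identityʳ _ ⟨
      τ ^ a * 1#                   ∎)

  instance
    N-nonZero : ℕ.NonZero N
    N-nonZero = ℕ.>-nonZero (ℕ.≤-trans (s≤s z≤n) 2≤N)

  τ-order : HasOrder τ N
  τ-order = minimal⇒HasOrder τ^N≈1 N≤order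

  x^N≈1 : ∀ {x} → ¬ x ≈ 0# → x ^ N ≈ 1#
  x^N≈1 {x} x≉0 = begin
    x ^ N                ≈⟨ ^-congˡ N (τ^log x x≉0) ⟨
    (τ ^ log x x≉0) ^ N  ≈⟨ ^-assocʳ τ (log x x≉0) N ⟩
    τ ^ (log x x≉0 ℕ.* N) ≈⟨ ^-∣ τ^N≈1 (n∣m*n (log x x≉0)) ⟩
    1#                   ∎

  -1^2≈1 : (- 1#) ^ 2 ≈ 1#
  -1^2≈1 = trans (*-congˡ (*-identityʳ _)) (trans (-1*x≈-x (- 1#)) (-‿involutive 1#))

  -1≉0 : ¬ - 1# ≈ 0#
  -1≉0 -1≈0 = 1≉0 (trans (sym (-‿involutive 1#)) (trans (-‿cong -1≈0) -0#≈0#))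

  -- When q is even, so is |F| = N + 1, and then -1 = (-1)ᴺ = 1.
  -1∈Fq : ∀ q → q ∣ suc N → InFq q (- 1#)
  -1∈Fq q q∣|F| = trans (^-% -1^2≈1 q) (by-parity (q % 2) ≡.refl (m%n<n q 2))
    where
    by-parity : ∀ r → q % 2 ≡ r → r < 2 → (- 1#) ^ r ≈ - 1#
    by-parity 0 q%2≡0 _ = sym (begin
      - 1#             ≈⟨ *-identityʳ _ ⟨
      (- 1#) ^ 1       ≡⟨ ≡.cong ((- 1#) ^_) N%2≡1 ⟨
      (- 1#) ^ (N % 2) ≈⟨ ^-% -1^2≈1 N ⟨
      (- 1#) ^ N       ≈⟨ x^N≈1 -1≉0 ⟩
      1#               ∎)
      where
      N%2≡1 : N % 2 ≡ 1
      N%2≡1 = %-pred-≡0 {N} (n∣m⇒m%n≡0 (suc N) 2 (∣-trans (m%n≡0⇒n∣m q 2 q%2≡0) q∣|F|))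
    by-parity 1 _ _ = *-identityʳ _
    by-parity (suc (suc _)) _ (s≤s (s≤s ()))

module Residues (t : ℕ) .{{_ : ℕ.NonZero t}} where
  open ≡.≡-Reasoning

  -- Definitionally FieldNotions.negMod t, which is only available relative to a ring.
  neg : ℕ → ℕ
  neg i = t ∸ i % t

  1≤neg : ∀ i → 1 ≤ neg i
  1≤neg i = ℕ.m<n⇒0<n∸m (m%n<n i t)

  neg≤t : ∀ i → neg i ≤ t
  neg≤t i = ℕ.m∸n≤m t (i % t)

  ∣+neg : ∀ i → t ∣ i ℕ.+ neg i
  ∣+neg i = ≡.subst (t ∣_) (≡.sym i+neg≡) (∣m∣n⇒∣m+n (n∣m*n (i / t)) ∣-refl)
    where
    i+neg≡ : i ℕ.+ neg i ≡ i / t ℕ.* t ℕ.+ t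
    i+neg≡ = begin
      i ℕ.+ (t ∸ i % t)                         ≡⟨ ≡.cong (ℕ._+ (t ∸ i % t)) (m≡m%n+[m/n]*n i t) ⟩
      (i % t ℕ.+ i / t ℕ.* t) ℕ.+ (t ∸ i % t)   ≡⟨ ≡.cong (ℕ._+ (t ∸ i % t)) (ℕ.+-comm (i % t) _) ⟩
      (i / t ℕ.* t ℕ.+ i % t) ℕ.+ (t ∸ i % t)   ≡⟨ ℕ.+-assoc (i / t ℕ.* t) _ _ ⟩
      i / t ℕ.* t ℕ.+ (i % t ℕ.+ (t ∸ i % t))   ≡⟨ ≡.cong (i / t ℕ.* t ℕ.+_) (ℕ.m+[n∸m]≡n (m%n≤n i t)) ⟩
      i / t ℕ.* t ℕ.+ t                         ∎

  neg-unique : ∀ i j → t ∣ i ℕ.+ j → j % t ≡ neg i % t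
  neg-unique i j t∣i+j = begin
    j % t                                     ≡⟨ %-remove-+ʳ j (∣+neg i) ⟨
    (j ℕ.+ (i ℕ.+ neg i)) % t            ≡⟨ ≡.cong (_% t) (ℕ.+-assoc j i _) ⟨
    (j ℕ.+ i ℕ.+ neg i) % t              ≡⟨ ≡.cong (λ k → (k ℕ.+ neg i) % t) (ℕ.+-comm j i) ⟩
    (i ℕ.+ j ℕ.+ neg i) % t              ≡⟨ %-remove-+ˡ (neg i) t∣i+j ⟩
    neg i % t                            ∎

  neg-involutive : ∀ i → neg (neg i) % t ≡ i % t
  neg-involutive i =
    ≡.sym (neg-unique (neg i) i (≡.subst (t ∣_) (ℕ.+-comm i _) (∣+neg i)))

  neg-cong : ∀ {i j} → i % t ≡ j % t → neg i ≡ neg j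
  neg-cong = ≡.cong (t ∸_)

module InverseClosureCriterion {c ℓ : Level} (F : CommutativeRing c ℓ) where
  open CommutativeRing F
  open FieldNotions F
  open Powers F
  open LowerTriangular F
  open Spans F
  open import Relation.Binary.Reasoning.Setoid setoid
  open import Algebra.Properties.Ring ring using (-‿involutive; +-inverseʳ-unique)

  module _ (q : ℕ) {m : ℕ} (b : Vector Carrier m) (τ θ : Carrier)
           (t : ℕ) .{{_ : ℕ.NonZero t}} (φ : Permutation′ t)
           (θ-order : HasOrder θ t) (-1∈Fq : InFq q (- 1#))
           (InMj? : ∀ j α → Dec (InMj q b τ j α)) where
    open Residues t

    M : ℕ → Carrier → Set (c ⊔ ℓ)
    M i = InMj q b τ (φ̂ t φ i)

    f : Mat
    f = mat 1# 0# 0# θ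

    S : Mat → Set (c ⊔ ℓ)
    S = InS q b τ θ t φ

    Criterion : Set (c ⊔ ℓ)
    Criterion = ∀ i α → (∃ λ β → M i β × (α ≈ β * θ ^ i)) ⇔ M (neg i) α

    M-resp : ∀ i → M i Respects _≈_
    M-resp i = InMj-resp q b τ (φ̂ t φ i)

    M-neg : ∀ i {α} → M i α → M i (- α)
    M-neg i = InMj-neg q b τ (φ̂ t φ i) -1∈Fq

    M-residue : ∀ {i j} → i % t ≡ j % t → ∀ {α} → M i α → M j α
    M-residue i≡j {α} = ≡.subst (λ k → InMj q b τ k α)
      (≡.cong (λ k → toℕ (φ ⟨$⟩ʳ k)) (Fin.fromℕ<-cong _ _ i≡j (m%n<n _ t) (m%n<n _ t)))

    θ^t≈1 : θ ^ t ≈ 1#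
    θ^t≈1 = Equivalence.from (θ-order t) ∣-refl

    θ^i*θ^[-i]≈1 : ∀ i → θ ^ i * θ ^ neg i ≈ 1#
    θ^i*θ^[-i]≈1 i = trans (sym (^-homo-* θ i (neg i))) (Equivalence.from (θ-order _) (∣+neg i))

    θ^i*[θ^[-i]*x]≈x : ∀ i x → θ ^ i * (θ ^ neg i * x) ≈ x
    θ^i*[θ^[-i]*x]≈x i x = trans (sym (*-assoc _ _ x)) (trans (*-congʳ (θ^i*θ^[-i]≈1 i)) (*-identityˡ x))

    θ^[-i]*[θ^i*x]≈x : ∀ i x → θ ^ neg i * (θ ^ i * x) ≈ x
    θ^[-i]*[θ^i*x]≈x i x =
      trans (sym (*-assoc _ _ x)) (trans (*-congʳ (trans (*-comm _ _) (θ^i*θ^[-i]≈1 i))) (*-identityˡ x))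

    f^i·n·f^j·n : ∀ i j α β → (f ^ₘ i · nElt α) · (f ^ₘ j · nElt β) ≈ₘ
                  lower (θ ^ i * α + θ ^ i * (θ ^ j * β)) (θ ^ i * θ ^ j)
    f^i·n·f^j·n i j α β = ≈ₘ-trans (·-cong (diag^·nElt θ i α) (diag^·nElt θ j β)) (lower-· _ _ _ _)

    -- (fⁱ n(α))⁻¹ = f⁻ⁱ n(-θⁱα)
    criterion⇒closed : Criterion → InverseClosed S
    criterion⇒closed criterion X (i , _ , _ , α , α∉Mi , X≈) =
      f ^ₘ neg i · nElt β , (neg i , 1≤neg i , neg≤t i , β , β∉M[-i] , ≈ₘ-refl) , X·Y≈I
      where
      β : Carrier
      β = - (θ ^ i * α)

      β∉M[-i] : ¬ M (neg i) β
      β∉M[-i] β∈ with Equivalence.from (criterion i (θ ^ i * α)) (M-resp _ (-‿involutive _) (M-neg _ β∈))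
      ... | α′ , α′∈Mi , θⁱα≈α′θⁱ = α∉Mi (M-resp i α′≈α α′∈Mi)
        where
        α′≈α : α′ ≈ α
        α′≈α = begin
          α′                         ≈⟨ θ^[-i]*[θ^i*x]≈x i α′ ⟨
          θ ^ neg i * (θ ^ i * α′)   ≈⟨ *-congˡ (*-comm _ _) ⟩
          θ ^ neg i * (α′ * θ ^ i)   ≈⟨ *-congˡ θⁱα≈α′θⁱ ⟨
          θ ^ neg i * (θ ^ i * α)    ≈⟨ θ^[-i]*[θ^i*x]≈x i α ⟩
          α                          ∎

      X·Y≈I : X · (f ^ₘ neg i · nElt β) ≈ₘ Iₘ
      X·Y≈I = ≈ₘ-trans (·-cong X≈ ≈ₘ-refl) (≈ₘ-trans (f^i·n·f^j·n i (neg i) α β)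
        (refl , refl , trans (+-congˡ (θ^i*[θ^[-i]*x]≈x i β)) (-‿inverseʳ _) , θ^i*θ^[-i]≈1 i))

    -- Since θ has order t, an inverse of fⁱ n(α) in S must lie in f^(t-i) N.
    closed⇒¬M : InverseClosed S → ∀ i → 1 ≤ i → i ≤ t → ∀ {α} → ¬ M i α → ¬ M (neg i) (θ ^ i * α)
    closed⇒¬M closed i 1≤i i≤t {α} α∉Mi θⁱα∈
      with closed (f ^ₘ i · nElt α) (i , 1≤i , i≤t , α , α∉Mi , ≈ₘ-refl)
    ... | Y , (j , _ , _ , β , β∉Mj , Y≈) , X·Y≈I =
      β∉Mj (M-residue -i≡j (M-resp (neg i) (sym β≈-θⁱα) (M-neg (neg i) θⁱα∈)))
      where
      product : lower (θ ^ i * α + θ ^ i * (θ ^ j * β)) (θ ^ i * θ ^ j) ≈ₘ Iₘ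
      product = ≈ₘ-trans (≈ₘ-sym (f^i·n·f^j·n i j α β)) (≈ₘ-trans (·-cong ≈ₘ-refl (≈ₘ-sym Y≈)) X·Y≈I)

      θ^i*θ^j≈1 : θ ^ i * θ ^ j ≈ 1#
      θ^i*θ^j≈1 = proj₂ (proj₂ (proj₂ product))

      -i≡j : neg i % t ≡ j % t
      -i≡j = ≡.sym (neg-unique i j (Equivalence.to (θ-order (i ℕ.+ j)) (trans (^-homo-* θ i j) θ^i*θ^j≈1)))

      β≈-θⁱα : β ≈ - (θ ^ i * α)
      β≈-θⁱα = +-inverseʳ-unique _ β (begin
        θ ^ i * α + β                    ≈⟨ +-congˡ (*-identityˡ β) ⟨
        θ ^ i * α + 1# * β               ≈⟨ +-congˡ (*-congʳ θ^i*θ^j≈1) ⟨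
        θ ^ i * α + θ ^ i * θ ^ j * β    ≈⟨ +-congˡ (*-assoc _ _ β) ⟩
        θ ^ i * α + θ ^ i * (θ ^ j * β)  ≈⟨ proj₁ (proj₂ (proj₂ product)) ⟩
        0#                               ∎)

    -- The contrapositive of closed⇒¬M (M is decidable), applied to the representative neg (neg i) ∈ [1, t] of i.
    closed⇒reflects : InverseClosed S → ∀ i α → M (neg i) (θ ^ i * α) → M i α
    closed⇒reflects closed i α θⁱα∈ = decidable-stable (InMj? (φ̂ t φ i) α) λ α∉Mi →
      closed⇒¬M closed i′ (1≤neg _) (neg≤t _) (α∉Mi ∘ M-residue i′≡i)
        (≡.subst (λ k → M k (θ ^ i′ * α)) (neg-cong (≡.sym i′≡i))
          (M-resp (neg i) (*-congʳ (^-cong-% θ^t≈1 (≡.sym i′≡i))) θⁱα∈))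
      where
      i′ : ℕ
      i′ = neg (neg i)

      i′≡i : i′ % t ≡ i % t
      i′≡i = neg-involutive i

    closed⇒criterion : InverseClosed S → Criterion
    closed⇒criterion closed i α = mk⇔
      (λ (β , β∈Mi , α≈βθⁱ) → closed⇒reflects closed (neg i) α
         (M-residue (≡.sym (neg-involutive i)) (M-resp i (θ^[-i]α≈β α≈βθⁱ) β∈Mi)))
      (λ α∈M[-i] → θ ^ neg i * α ,
         closed⇒reflects closed i _ (M-resp (neg i) (sym (θ^i*[θ^[-i]*x]≈x i α)) α∈M[-i]) ,
         sym (trans (*-comm _ _) (θ^i*[θ^[-i]*x]≈x i α)))
      where
      θ^[-i]α≈β : ∀ {β} → α ≈ β * θ ^ i → β ≈ θ ^ neg i * α
      θ^[-i]α≈β {β} α≈βθⁱ = begin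
        β                          ≈⟨ θ^[-i]*[θ^i*x]≈x i β ⟨
        θ ^ neg i * (θ ^ i * β)    ≈⟨ *-congˡ (trans (*-comm _ _) (sym α≈βθⁱ)) ⟩
        θ ^ neg i * α              ∎

    criterion : InverseClosed S ⇔ Criterion
    criterion = mk⇔ closed⇒criterion criterion⇒closed

IsPrimePower⇒2≤ : ∀ {q} → IsPrimePower q → 2 ≤ q
IsPrimePower⇒2≤ (p , k , p-prime , 1≤k , ≡.refl) = ℕ.≤-trans (ℕ.nonTrivial⇒n>1 p {{prime⇒nonTrivial p-prime}})
  (ℕ.≤-trans (ℕ.≤-reflexive (≡.sym (ℕ.*-identityʳ p))) (ℕ.^-monoʳ-≤ p {{prime⇒nonZero p-prime}} 1≤k))

m∣m^n : ∀ m n → 1 ≤ n → m ∣ m ℕ.^ n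
m∣m^n m (suc n) _ = m∣m*n (m ℕ.^ n)

lemma1 : {c ℓ : Level} (F : CommutativeRing c ℓ) →
  let open CommutativeRing F
      open FieldNotions F
  in (q r : ℕ) → IsPrimePower q → 1 < r →
     IsField → HasCard (q ℕ.^ r) →
     (τ : Carrier) → Primitive τ →
     (θ : Carrier) → θ ≈ τ ^ (q ∸ 1) →
     (t : ℕ) .{{_ : ℕ.NonZero t}} → t ℕ.* (q ∸ 1) ≡ q ℕ.^ r ∸ 1 →
     (b : Fin (r ∸ 1) → Carrier) → LinIndep q b →
     (φ : Permutation′ t) →
     InverseClosed (InS q b τ θ t φ) ⇔
       (∀ (i : ℕ) (α : Carrier) →
          (∃ λ β → InMj q b τ (φ̂ t φ i) β × (α ≈ β * (θ ^ i)))
          ⇔ InMj q b τ (φ̂ t φ (negMod t i)) α)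
lemma1 F q r q-primePower 1<r isField card τ τ-primitive θ θ≈τ^[q-1] t t[q-1]≡N b _ φ =
  InverseClosureCriterion.criterion F q b τ θ t φ θ-order (𝔽.-1∈Fq q q∣|F|) (FiniteSearch.InMj? F card q b τ)
  where
  open FieldNotions F
  open Powers F

  N : ℕ
  N = q ℕ.^ r ∸ 1

  2≤q : 2 ≤ q
  2≤q = IsPrimePower⇒2≤ q-primePower

  4≤q^r : 4 ≤ q ℕ.^ r
  4≤q^r = ℕ.≤-trans (ℕ.^-monoʳ-≤ 2 1<r) (ℕ.^-monoˡ-≤ r 2≤q)

  |F|≡q^r : suc N ≡ q ℕ.^ r
  |F|≡q^r = ℕ.m+[n∸m]≡n (ℕ.≤-trans (s≤s z≤n) 4≤q^r)

  module 𝔽 = PrimitiveElement F isField (≡.subst HasCard (≡.sym |F|≡q^r) card)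
                                (ℕ.∸-monoˡ-≤ 1 (ℕ.≤-trans (ℕ.n≤1+n 3) 4≤q^r)) τ τ-primitive

  instance
    q-1≢0 : ℕ.NonZero (q ∸ 1)
    q-1≢0 = ℕ.>-nonZero (ℕ.m<n⇒0<n∸m 2≤q)

  θ-order : HasOrder θ t
  θ-order = HasOrder-^ (≡.subst (HasOrder τ) (≡.sym t[q-1]≡N) 𝔽.τ-order) θ≈τ^[q-1]

  q∣|F| : q ∣ suc N
  q∣|F| = ≡.subst (q ∣_) (≡.sym |F|≡q^r) (m∣m^n q r (ℕ.<⇒≤ 1<r))
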